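{- Let $\mathcal{H}$ be a fixed finite set of connected graphs each of diameter at most $D$, containing $K_{1,s}$ for some $s>1$, with $s$ the least such integer. Let $t>2$, $d=R(s,t-1)-1$, and let $(G,k)$ be an instance of $\mathcal{H}$-free Edge Deletion with $G$ $K_t$-free. Let $V_R(G)$ be the set of vertices of $G$ of degree at least $d+1$, and let $G'$ be obtained from $G$ by deleting all vertices at distance more than $(2+\log_{\frac{2d}{2d-1}}k)D$ from $V_{\mathcal{H}}(G)\cup V_R(G)$. Then $(G,k)$ is a yes-instance if and only if $(G',k)$ is a yes-instance.
   Context: All graphs are finite and simple. $R(s,t)$ is the Ramsey number. A graph is $\mathcal{H}$-free if it has no induced subgraph isomorphic to a member of $\mathcal{H}$. $\mathcal{H}$-free Edge Deletion: given $G$ and a positive integer $k$, decide whether some $E'\subseteq E(G)$ with $|E'|\le k$ makes $G\setminus E'=(V(G),E(G)\setminus E')$ $\mathcal{H}$-free. $V_{\mathcal{H}}(G)$ is the set of vertices of $G$ lying in some induced copy of a member of $\mathcal{H}$. The distance from a vertex to a vertex set is the minimum distance to its elements. -}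

module Defs where

open import Data.Nat using (ℕ; zero; suc; _+_; _*_; _∸_; _^_; _≤_; _<_)
open import Data.Fin using (Fin; zero; suc; _≟_)
open import Data.Bool using (Bool; true; false; _∧_; _∨_; not; if_then_else_)
open import Data.Bool.Properties using (∨-comm)
open import Data.List using (List; []; _∷_; length; map; allFin)
open import Data.Nat.ListAction using (sum)
open import Data.Bool.ListAction using (any)
open import Data.List.Membership.Propositional using (_∈_)
open import Data.Product using (Σ; ∃; _×_; _,_; proj₁; proj₂)
open import Data.Sum using (_⊎_)
open import Data.Empty using (⊥-elim)
open import Relation.Nullary using (¬_; yes; no)
open import Relation.Nullary.Decidable using (⌊_⌋)
open import Relation.Binary.PropositionalEquality using (_≡_; refl; sym; cong; cong₂)
open import Function.Bundles using (_↔_; Inverse)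
open import Function.Definitions using (Injective)

record Graph : Set where
  field
    n       : ℕ
    adj     : Fin n → Fin n → Bool
    adj-sym : ∀ i j → adj i j ≡ adj j i
    adj-irr : ∀ i → adj i i ≡ false
open Graph public

Embedding : Graph → Graph → Set
Embedding H G = Σ (Fin (n H) → Fin (n G)) λ f →
  Injective _≡_ _≡_ f × (∀ i j → adj H i j ≡ adj G (f i) (f j))

Iso : Graph → Graph → Set
Iso H G = Σ (Fin (n H) ↔ Fin (n G)) λ φ →
  ∀ i j → adj H i j ≡ adj G (Inverse.to φ i) (Inverse.to φ j)

Free : List Graph → Graph → Set
Free ℋ G = ∀ H → H ∈ ℋ → ¬ Embedding H G

data Walk (G : Graph) : ℕ → Fin (n G) → Fin (n G) → Set where
  here : ∀ {u} → Walk G 0 u u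
  step : ∀ {ℓ u w v} → adj G u w ≡ true → Walk G ℓ w v → Walk G (suc ℓ) u v

ConnDiam : ℕ → Graph → Set
ConnDiam D H = 1 ≤ n H × (∀ u v → ∃ λ ℓ → ℓ ≤ D × Walk H ℓ u v)

starAdj : ∀ {s} → Fin (suc s) → Fin (suc s) → Bool
starAdj zero    zero    = false
starAdj zero    (suc _) = true
starAdj (suc _) zero    = true
starAdj (suc _) (suc _) = false

starSym : ∀ {s} (i j : Fin (suc s)) → starAdj i j ≡ starAdj j i
starSym zero    zero    = refl
starSym zero    (suc _) = refl
starSym (suc _) zero    = refl
starSym (suc _) (suc _) = refl

starIrr : ∀ {s} (i : Fin (suc s)) → starAdj i i ≡ false
starIrr zero    = refl
starIrr (suc _) = refl

Star : ℕ → Graph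
Star s = record { n = suc s ; adj = starAdj ; adj-sym = starSym ; adj-irr = starIrr }

eqb : ∀ {m} → Fin m → Fin m → Bool
eqb i j = ⌊ i ≟ j ⌋

eqb-sym : ∀ {m} (i j : Fin m) → eqb i j ≡ eqb j i
eqb-sym i j with i ≟ j | j ≟ i
... | yes _ | yes _ = refl
... | no _  | no _  = refl
... | yes p | no q  = ⊥-elim (q (sym p))
... | no p  | yes q = ⊥-elim (p (sym q))

eqb-refl : ∀ {m} (i : Fin m) → eqb i i ≡ true
eqb-refl i with i ≟ i
... | yes _ = refl
... | no p  = ⊥-elim (p refl)

Complete : ℕ → Graph
Complete t = record
  { n = t
  ; adj = λ i j → not (eqb i j)
  ; adj-sym = λ i j → cong not (eqb-sym i j)
  ; adj-irr = λ i → cong not (eqb-refl i) }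

Edgeless : ℕ → Graph
Edgeless b = record { n = b ; adj = λ _ _ → false ; adj-sym = λ _ _ → refl ; adj-irr = λ _ → refl }

KFree : ℕ → Graph → Set
KFree t G = ¬ Embedding (Complete t) G

RamseyProp : ℕ → ℕ → ℕ → Set
RamseyProp a b N = ∀ (G : Graph) → n G ≡ N →
  Embedding (Complete a) G ⊎ Embedding (Edgeless b) G

IsRamsey : ℕ → ℕ → ℕ → Set
IsRamsey a b N = RamseyProp a b N × (∀ M → M < N → ¬ RamseyProp a b M)

degree : (G : Graph) → Fin (n G) → ℕ
degree G v = sum (map (λ j → if adj G v j then 1 else 0) (allFin (n G)))

VH : List Graph → (G : Graph) → Fin (n G) → Set
VH ℋ G v = ∃ λ H → H ∈ ℋ × Σ (Embedding H G) λ e → ∃ λ i → proj₁ e i ≡ v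

VR : ℕ → (G : Graph) → Fin (n G) → Set
VR d G v = suc d ≤ degree G v

-- ℓ ≤ (2 + log_{2d/(2d-1)} k)·D, rephrased in ℕ:
-- (2d)^(ℓ ∸ 2D) ≤ k^D · (2d-1)^(ℓ ∸ 2D).
WithinBound : ℕ → ℕ → ℕ → ℕ → Set
WithinBound d k D ℓ = (2 * d) ^ (ℓ ∸ 2 * D) ≤ k ^ D * (2 * d ∸ 1) ^ (ℓ ∸ 2 * D)

Kept : List Graph → ℕ → ℕ → ℕ → (G : Graph) → Fin (n G) → Set
Kept ℋ d k D G v = ∃ λ u → (VH ℋ G u ⊎ VR d G u) ×
  ∃ λ ℓ → Walk G ℓ u v × WithinBound d k D ℓ

InducedOn : (G : Graph) → (Fin (n G) → Set) → Graph → Set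
InducedOn G P G' = Σ (Fin (n G') → Fin (n G)) λ f →
  Injective _≡_ _≡_ f × (∀ i j → adj G' i j ≡ adj G (f i) (f j)) ×
  (∀ i → P (f i)) × (∀ v → P v → ∃ λ i → f i ≡ v)

hit : ∀ {m} → List (Fin m × Fin m) → Fin m → Fin m → Bool
hit L i j = any (λ p → eqb (proj₁ p) i ∧ eqb (proj₂ p) j) L

deleteEdges : (G : Graph) → List (Fin (n G) × Fin (n G)) → Graph
deleteEdges G L = record
  { n = n G
  ; adj = λ i j → adj G i j ∧ not (hit L i j ∨ hit L j i)
  ; adj-sym = λ i j → cong₂ _∧_ (adj-sym G i j) (cong not (∨-comm (hit L i j) (hit L j i)))
  ; adj-irr = λ i → cong (_∧ not (hit L i i ∨ hit L i i)) (adj-irr G i) }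

YesInstance : List Graph → Graph → ℕ → Set
YesInstance ℋ G k = ∃ λ (L : List (Fin (n G) × Fin (n G))) →
  length L ≤ k × Free ℋ (deleteEdges G L)

-- Only the degree bound d off V_ℋ ∪ V_R and the diameter bound D matter. A solution for G restricts
-- to one for G′. Conversely, take a minimum solution F of G′ and let c r count the edges of F with
-- both ends at distance > r from V_ℋ ∪ V_R. Dropping the edges counted by c (r + D) and replacing
-- the other edges counted by c r by all (at most 2d) edges at their endpoints still gives a
-- solution, since a copy of a member of ℋ cannot reach the isolated endpoints and cannot lie that
-- far out; minimality then yields 2d · c (r + D) ≤ (2d − 1) · c r, hence
-- (2d)^j · c (j D) ≤ (2d − 1)^j · k. A copy in G minus F that leaves G′ must use an edge of F
-- within D of a vertex at distance δ from V_ℋ ∪ V_R, so c (δ − D − 1) ≥ 1, which this decay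
-- turns into δ being within the bound: the vertex was kept after all.
module Submission where

open import Defs
open import Data.Nat using (ℕ; zero; suc; _+_; _*_; _∸_; _^_; _≤_; _<_; z≤n; s≤s; s≤s⁻¹; _≤?_; NonZero)
open import Data.Nat.Base using (>-nonZero)
open import Data.Nat.Properties hiding (_≟_)
open import Data.Nat.DivMod using (_/_; _%_; m≡m%n+[m/n]*n; m%n<n; m/n*n≤m)
open import Data.Nat.Induction using (<-rec)
open import Data.Nat.ListAction using (sum)
open import Data.Nat.Solver using (module +-*-Solver)
open import Data.Fin using (Fin; zero; suc; _≟_)
open import Data.Fin.Properties using (any?; all?; ¬∀⟶∃¬)
open import Data.Bool using (true; false; _∧_; _∨_; not; if_then_else_)
open import Data.Bool.Properties using (∧-zeroʳ; ∧-identityʳ; ∧-conicalˡ; ∨-zeroʳ; ¬-not; ⇔→≡)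
  renaming (_≟_ to _≟ᵇ_)
open import Data.List using (List; []; _∷_; length; map; allFin; _++_; filter)
open import Data.List.Properties using (length-map; length-++; length-filter; filter-some)
open import Data.List.Relation.Unary.Any as Any using (here; there)
import Data.List.Relation.Unary.All as All
open import Data.List.Membership.Propositional using (_∈_; find; lose)
open import Data.List.Membership.Propositional.Properties
  using (∈-filter⁺; ∈-filter⁻; ∈-++⁺ˡ; ∈-++⁺ʳ; ∈-++⁻; ∈-allFin; ∈-map⁻)
open import Data.Product using (Σ; ∃; _×_; _,_; proj₁; proj₂)
open import Data.Sum using (_⊎_; inj₁; inj₂; [_,_])
open import Data.Empty using (⊥-elim)
open import Relation.Unary using (Decidable)
open import Relation.Nullary using (¬_; Dec; yes; no; contradiction)
open import Relation.Nullary.Decidable using (_×-dec_; _⊎-dec_; _→-dec_; ¬?; map′)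
open import Relation.Binary.PropositionalEquality hiding ([_])
open import Function using (_∘_; id)
open import Function.Bundles using (_⇔_; mk⇔; Inverse)
open import Function.Definitions using (Injective)
open +-*-Solver using (solve; _:+_; _:*_; _:=_; con)

∈⇒hit : ∀ {m} {L : List (Fin m × Fin m)} {a b} → (a , b) ∈ L → hit L a b ≡ true
∈⇒hit {a = a} {b} (here refl) rewrite eqb-refl a | eqb-refl b = refl
∈⇒hit (there a,b∈L) rewrite ∈⇒hit a,b∈L = ∨-zeroʳ _

hit⇒∈ : ∀ {m} (L : List (Fin m × Fin m)) {a b} → hit L a b ≡ true → (a , b) ∈ L
hit⇒∈ [] ()
hit⇒∈ ((x , y) ∷ L) {a} {b} h with x ≟ a | y ≟ b
... | yes refl | yes refl = here refl
... | yes _    | no _     = there (hit⇒∈ L h)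
... | no _     | _        = there (hit⇒∈ L h)

eqb-injective : ∀ {m m′} {f : Fin m → Fin m′} → Injective _≡_ _≡_ f → ∀ x y → eqb (f x) (f y) ≡ eqb x y
eqb-injective {f = f} f-inj x y with f x ≟ f y | x ≟ y
... | yes _    | yes _ = refl
... | no _     | no _  = refl
... | yes fx≡fy | no x≢y = contradiction (f-inj fx≡fy) x≢y
... | no fx≢fy | yes refl = contradiction refl fx≢fy

hit-map : ∀ {m m′} {f : Fin m → Fin m′} → Injective _≡_ _≡_ f → ∀ L a b →
  hit (map (λ p → f (proj₁ p) , f (proj₂ p)) L) (f a) (f b) ≡ hit L a b
hit-map f-inj []            a b = refl
hit-map f-inj ((x , y) ∷ L) a b =
  cong₂ _∨_ (cong₂ _∧_ (eqb-injective f-inj x a) (eqb-injective f-inj y b)) (hit-map f-inj L a b)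

module _ (X : Graph) (L : List (Fin (n X) × Fin (n X))) where

  deleteEdges-⊆ : ∀ {a b} → adj (deleteEdges X L) a b ≡ true → adj X a b ≡ true
  deleteEdges-⊆ = ∧-conicalˡ _ _

  deleteEdges-hit : ∀ {a b} → hit L a b ≡ true → adj (deleteEdges X L) a b ≡ false
  deleteEdges-hit {a} {b} h rewrite h = ∧-zeroʳ (adj X a b)

  deleteEdges-unhit : ∀ {a b} → hit L a b ≡ false → hit L b a ≡ false →
    adj (deleteEdges X L) a b ≡ adj X a b
  deleteEdges-unhit {a} {b} h h′ rewrite h | h′ = ∧-identityʳ (adj X a b)

  deleteEdges-cong : ∀ L′ {a b} → hit L a b ≡ hit L′ a b → hit L b a ≡ hit L′ b a →
    adj (deleteEdges X L) a b ≡ adj (deleteEdges X L′) a b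
  deleteEdges-cong L′ h h′ rewrite h | h′ = refl

embedding-along : ∀ {H X Y} (e : Embedding H X) (g : Fin (n X) → Fin (n Y)) → Injective _≡_ _≡_ g →
  (∀ i j → adj X (proj₁ e i) (proj₁ e j) ≡ adj Y (g (proj₁ e i)) (g (proj₁ e j))) → Embedding H Y
embedding-along (e , e-inj , e-adj) g g-inj g-adj =
  g ∘ e , (λ eq → e-inj (g-inj eq)) , λ i j → trans (e-adj i j) (g-adj i j)

point-embedding : ∀ H X (i₀ : Fin (n H)) → (∀ j → j ≡ i₀) → Fin (n X) → Embedding H X
point-embedding H X i₀ only v = (λ _ → v) , (λ _ → trans (only _) (sym (only _))) , adj-const
  where
  adj-const : ∀ i j → adj H i j ≡ adj X v v
  adj-const i j rewrite only i | only j = trans (adj-irr H i₀) (sym (adj-irr X v))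

∘-embedding : ∀ {H X Y} → Embedding X Y → Embedding H X → Embedding H Y
∘-embedding {H} {X} {Y} (g , g-inj , g-adj) e = embedding-along {H} {X} {Y} e g g-inj (λ i j → g-adj _ _)

unhit-embedding : ∀ {H} X L (e : Embedding H (deleteEdges X L)) →
  (∀ i j → hit L (proj₁ e i) (proj₁ e j) ≡ false) → Embedding H X
unhit-embedding {H} X L e unhit =
  embedding-along {H} {deleteEdges X L} {X} e id (λ eq → eq) (λ i j → deleteEdges-unhit X L (unhit i j) (unhit j i))

EdgePreserving : (X Y : Graph) → (Fin (n X) → Fin (n Y)) → Set
EdgePreserving X Y g = ∀ {i j} → adj X i j ≡ true → adj Y (g i) (g j) ≡ true

embedding-edgePreserving : ∀ {H X} (e : Embedding H X) → EdgePreserving H X (proj₁ e)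
embedding-edgePreserving (_ , _ , e-adj) {i} {j} h = trans (sym (e-adj i j)) h

walk-++ : ∀ {G a b u v w} → Walk G a u v → Walk G b v w → Walk G (a + b) u w
walk-++ here       q = q
walk-++ (step e p) q = step e (walk-++ p q)

walk-map : ∀ {X Y} (g : Fin (n X) → Fin (n Y)) → EdgePreserving X Y g →
  ∀ {ℓ u v} → Walk X ℓ u v → Walk Y ℓ (g u) (g v)
walk-map g hom here       = here
walk-map g hom (step e p) = step (hom e) (walk-map g hom p)

walk? : ∀ X ℓ u v → Dec (Walk X ℓ u v)
walk? X zero u v with u ≟ v
... | yes refl = yes here
... | no u≢v   = no λ { here → u≢v refl }
walk? X (suc ℓ) u v = map′ (λ (w , e , p) → step e p) (λ { (step e p) → _ , e , p })
  (any? (λ w → (adj X u w ≟ᵇ true) ×-dec walk? X ℓ w v))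

connected-neighbour : ∀ {D H} → ConnDiam D H → ∀ {i j} → i ≢ j → ∃ λ w → adj H i w ≡ true
connected-neighbour (_ , conn) {i} {j} i≢j with conn i j
... | _ , _ , here       = contradiction refl i≢j
... | _ , _ , step e _   = _ , e

walk-zero : ∀ {X u v} → Walk X 0 u v → u ≡ v
walk-zero here = refl

nonZero-diameter : ∀ {D H s} → 1 < s → ConnDiam D H → Iso H (Star s) → NonZero D
nonZero-diameter {suc D} _ _ _ = _
nonZero-diameter {zero} {s = suc s} _ (_ , conn) (φ , _) with conn (Inverse.from φ zero) (Inverse.from φ (suc zero))
... | .0 , z≤n , walk = contradiction 0≡1 λ ()
  where
  open Inverse φ
  0≡1 : zero ≡ suc zero
  0≡1 = trans (sym (strictlyInverseˡ zero))
              (trans (cong to (walk-zero walk)) (strictlyInverseˡ (suc zero)))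

Minimal : (ℕ → Set) → ℕ → Set
Minimal P m = P m × (∀ {i} → i < m → ¬ P i)

minimal : ∀ {P : ℕ → Set} → Decidable P → ∀ {n} → P n → ∃ (Minimal P)
minimal {P} P? {n} = <-rec (λ n → P n → ∃ (Minimal P)) search n
  where
  search : ∀ n → (∀ {i} → i < n → P i → ∃ (Minimal P)) → P n → ∃ (Minimal P)
  search n below pn with anyUpTo? P? n
  ... | yes (i , i<n , pi) = below i<n pi
  ... | no none            = n , pn , λ i<n pi → none (_ , i<n , pi)

∃-function? : ∀ a b (P : (Fin a → Fin b) → Set) → (∀ {f g} → (∀ i → f i ≡ g i) → P f → P g) →
  (∀ f → Dec (P f)) → Dec (∃ P)
∃-function? zero b P resp P? = map′ (empty ,_) (λ (f , pf) → resp (λ ()) pf) (P? empty)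
  where
  empty : Fin zero → Fin b
  empty ()
∃-function? (suc a) b P resp P? =
  map′ (λ (x , g , p) → cons x g , p)
       (λ (f , pf) → f zero , f ∘ suc , resp (λ { zero → refl ; (suc i) → refl }) pf)
       (any? λ x → ∃-function? a b (P ∘ cons x)
                     (λ eq → resp λ { zero → refl ; (suc i) → eq i }) (P? ∘ cons x))
  where
  cons : Fin b → (Fin a → Fin b) → Fin (suc a) → Fin b
  cons x g zero    = x
  cons x g (suc i) = g i

IsEmbedding : (H X : Graph) → (Fin (n H) → Fin (n X)) → Set
IsEmbedding H X f = Injective _≡_ _≡_ f × (∀ i j → adj H i j ≡ adj X (f i) (f j))

isEmbedding? : ∀ H X f → Dec (IsEmbedding H X f)
isEmbedding? H X f = injective? ×-dec all? (λ i → all? (λ j → adj H i j ≟ᵇ adj X (f i) (f j)))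
  where
  injective? : Dec (Injective _≡_ _≡_ f)
  injective? = map′ (λ inj {x} {y} → inj x y) (λ inj x y → inj)
    (all? λ x → all? λ y → (f x ≟ f y) →-dec (x ≟ y))

isEmbedding-resp : ∀ H X {f g} → (∀ i → f i ≡ g i) → IsEmbedding H X f → IsEmbedding H X g
isEmbedding-resp H X {f} {g} f≗g (inj , f-adj) =
  (λ {x} {y} eq → inj (trans (f≗g x) (trans eq (sym (f≗g y))))) ,
  λ i j → trans (f-adj i j) (cong₂ (adj X) (f≗g i) (f≗g j))

embedding? : ∀ H X → Dec (Embedding H X)
embedding? H X = ∃-function? _ _ (IsEmbedding H X) (isEmbedding-resp H X) (isEmbedding? H X)

embeddingThrough? : ∀ H X v → Dec (Σ (Embedding H X) λ e → ∃ λ i → proj₁ e i ≡ v)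
embeddingThrough? H X v =
  map′ (λ (f , emb , through) → (f , emb) , through) (λ ((f , emb) , through) → f , emb , through)
    (∃-function? _ _ (λ f → IsEmbedding H X f × ∃ λ i → f i ≡ v)
      (λ f≗g (emb , i , fi≡v) → isEmbedding-resp H X f≗g emb , i , trans (sym (f≗g i)) fi≡v)
      (λ f → isEmbedding? H X f ×-dec any? (λ i → f i ≟ v)))

free? : ∀ ℋ X → Dec (Free ℋ X)
free? ℋ X = map′ (λ none H H∈ℋ → All.lookup none H∈ℋ) (λ free → All.tabulate (free _))
  (All.all? (λ H → ¬? (embedding? H X)) ℋ)

VH? : ∀ ℋ X v → Dec (VH ℋ X v)
VH? ℋ X v = map′ find (λ (H , H∈ℋ , e) → lose H∈ℋ e) (Any.any? (λ H → embeddingThrough? H X v) ℋ)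

∃-pair? : ∀ {m} {R : Fin m × Fin m → Set} → (∀ p → Dec (R p)) → Dec (∃ R)
∃-pair? R? = map′ (λ (i , j , r) → (i , j) , r) (λ ((i , j) , r) → i , j , r)
  (any? λ i → any? λ j → R? (i , j))

∃-shortList? : ∀ {m} {Q : List (Fin m × Fin m) → Set} → (∀ L → Dec (Q L)) → ∀ k →
  Dec (∃ λ L → length L ≤ k × Q L)
∃-shortList? Q? k with Q? []
... | yes q = yes ([] , z≤n , q)
∃-shortList? Q? zero    | no ¬q = no λ { ([] , _ , q) → ¬q q }
∃-shortList? Q? (suc k) | no ¬q =
  map′ (λ (x , L , le , q) → x ∷ L , s≤s le , q)
       (λ { ([] , _ , q) → ⊥-elim (¬q q) ; (x ∷ L , s≤s le , q) → x , L , le , q })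
       (∃-pair? λ x → ∃-shortList? (Q? ∘ (x ∷_)) k)

SolvableWithin : List Graph → (X : Graph) → ℕ → Set
SolvableWithin ℋ X m = ∃ λ L → length L ≤ m × Free ℋ (deleteEdges X L)

minimum-solution : ∀ ℋ X {k} → YesInstance ℋ X k →
  ∃ λ F → length F ≤ k × Free ℋ (deleteEdges X F) × (∀ L → Free ℋ (deleteEdges X L) → length F ≤ length L)
minimum-solution ℋ X {k} solvable
  with minimal {P = SolvableWithin ℋ X} (∃-shortList? (λ L → free? ℋ (deleteEdges X L))) solvable
... | m , (F , F≤m , F-solves) , none-below = F , ≤-trans F≤m m≤k , F-solves , minimum
  where
  m≤k : m ≤ k
  m≤k = ≮⇒≥ λ k<m → none-below k<m solvable
  minimum : ∀ L → Free ℋ (deleteEdges X L) → length F ≤ length L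
  minimum L L-solves = ≤-trans F≤m (≮⇒≥ λ L<m → none-below L<m (L , ≤-refl , L-solves))

module _ {A : Set} {P : A → Set} (P? : Decidable P) where

  length-filter-+-∁ : ∀ xs → length (filter P? xs) + length (filter (¬? ∘ P?) xs) ≡ length xs
  length-filter-+-∁ []       = refl
  length-filter-+-∁ (x ∷ xs) with P? x
  ... | yes _ = cong suc (length-filter-+-∁ xs)
  ... | no _  = trans (+-suc _ _) (cong suc (length-filter-+-∁ xs))

  module _ {Q : A → Set} (Q? : Decidable Q) (P⇒Q : ∀ {x} → P x → Q x) where

    length-filter-filter : ∀ xs → length (filter P? (filter Q? xs)) ≡ length (filter P? xs)
    length-filter-filter []       = refl
    length-filter-filter (x ∷ xs) with Q? x
    ... | yes _ with P? x
    ...   | yes _ = cong suc (length-filter-filter xs)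
    ...   | no _  = length-filter-filter xs
    length-filter-filter (x ∷ xs) | no ¬q with P? x
    ...   | yes p = contradiction (P⇒Q p) ¬q
    ...   | no _  = length-filter-filter xs

exchange-arith : ∀ a x y → x + y ≤ a * y → a * x ≤ (a ∸ 1) * (x + y)
exchange-arith zero    x y _ = z≤n
exchange-arith (suc q) x y x+y≤ = begin
    x + q * x      ≤⟨ +-monoˡ-≤ (q * x) x≤qy ⟩
    q * y + q * x  ≡⟨ +-comm (q * y) (q * x) ⟩
    q * x + q * y  ≡⟨ sym (*-distribˡ-+ q x y) ⟩
    q * (x + y)    ∎
  where
  open ≤-Reasoning
  x≤qy : x ≤ q * y
  x≤qy = +-cancelˡ-≤ y x (q * y) (subst (_≤ y + q * y) (+-comm x y) x+y≤)

^-distribʳ-* : ∀ a b m → (a * b) ^ m ≡ a ^ m * b ^ m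
^-distribʳ-* a b zero    = refl
^-distribʳ-* a b (suc m) rewrite ^-distribʳ-* a b m =
  solve 4 (λ a b x y → (a :* b) :* (x :* y) := (a :* x) :* (b :* y)) refl a b (a ^ m) (b ^ m)

^-ratio-bound : ∀ q k D j m → 1 ≤ q → suc q ^ j ≤ q ^ j * k → m ≤ j * D → suc q ^ m ≤ k ^ D * q ^ m
^-ratio-bound q k D j m q≥1 hyp m≤jD =
  *-cancelʳ-≤ (suc q ^ m) (k ^ D * q ^ m) (q ^ t) {{>-nonZero (m^n>0 q {{>-nonZero q≥1}} t)}} (begin
    a ^ m * q ^ t           ≤⟨ *-monoʳ-≤ (a ^ m) (^-monoˡ-≤ t (n≤1+n q)) ⟩
    a ^ m * a ^ t           ≡⟨ sym (^-distribˡ-+-* a m t) ⟩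
    a ^ (m + t)             ≡⟨ cong (a ^_) m+t≡jD ⟩
    a ^ (j * D)             ≡⟨ sym (^-*-assoc a j D) ⟩
    (a ^ j) ^ D             ≤⟨ ^-monoˡ-≤ D hyp ⟩
    (q ^ j * k) ^ D         ≡⟨ ^-distribʳ-* (q ^ j) k D ⟩
    (q ^ j) ^ D * k ^ D     ≡⟨ cong (_* k ^ D) (^-*-assoc q j D) ⟩
    q ^ (j * D) * k ^ D     ≡⟨ cong (λ z → q ^ z * k ^ D) (sym m+t≡jD) ⟩
    q ^ (m + t) * k ^ D     ≡⟨ cong (_* k ^ D) (^-distribˡ-+-* q m t) ⟩
    q ^ m * q ^ t * k ^ D   ≡⟨ solve 3 (λ a b c → a :* b :* c := c :* a :* b) refl (q ^ m) (q ^ t) (k ^ D) ⟩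
    k ^ D * q ^ m * q ^ t   ∎)
  where
  open ≤-Reasoning
  a = suc q
  t = j * D ∸ m
  m+t≡jD : m + t ≡ j * D
  m+t≡jD = m+[n∸m]≡n m≤jD

quotient-bounds : ∀ r D .{{_ : NonZero D}} → r / D * D ≤ r × r < suc (r / D) * D
quotient-bounds r D = m/n*n≤m r D , (begin-strict
    r                  ≡⟨ m≡m%n+[m/n]*n r D ⟩
    r % D + r / D * D  <⟨ +-monoˡ-< (r / D * D) (m%n<n r D) ⟩
    D + r / D * D      ∎)
  where open ≤-Reasoning

withinBound-intro : ∀ {d k D δ} → 1 ≤ k →
  (∀ m → δ ∸ 2 * D ≡ suc m → ∃ λ j → (2 * d) ^ j ≤ (2 * d ∸ 1) ^ j * k × suc m ≤ j * D) →
  WithinBound d k D δ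
withinBound-intro {d} {k} {D} {δ} k≥1 bound with δ ∸ 2 * D
... | zero  = ≤-trans (m^n>0 k {{>-nonZero k≥1}} D) (≤-reflexive (sym (*-identityʳ _)))
... | suc m = from-bound d (bound m refl)
  where
  from-bound : ∀ d → (∃ λ j → (2 * d) ^ j ≤ (2 * d ∸ 1) ^ j * k × suc m ≤ j * D) →
    (2 * d) ^ suc m ≤ k ^ D * (2 * d ∸ 1) ^ suc m
  from-bound zero     _              = z≤n
  from-bound (suc d₀) (j , hj , hm) =
    ^-ratio-bound (2 * suc d₀ ∸ 1) k D j (suc m) (≤-trans (s≤s z≤n) (m≤n+m (suc (d₀ + 0)) d₀)) hj hm

module Distance (ℋ : List Graph) (d : ℕ) (G : Graph) where

  Special : Fin (n G) → Set
  Special v = VH ℋ G v ⊎ VR d G v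

  special? : Decidable Special
  special? v = VH? ℋ G v ⊎-dec (suc d ≤? degree G v)

  ¬special⇒degree≤ : ∀ {v} → ¬ Special v → degree G v ≤ d
  ¬special⇒degree≤ ¬special = ≮⇒≥ (¬special ∘ inj₂)

  WalkFromSpecial : ℕ → Fin (n G) → Set
  WalkFromSpecial ℓ v = ∃ λ u → Special u × Walk G ℓ u v

  walkFromSpecial? : ∀ v ℓ → Dec (WalkFromSpecial ℓ v)
  walkFromSpecial? v ℓ = any? λ u → special? u ×-dec walk? G ℓ u v

  Near : ℕ → Fin (n G) → Set
  Near r v = ∃ λ ℓ → ℓ ≤ r × WalkFromSpecial ℓ v

  near? : ∀ r v → Dec (Near r v)
  near? r v = map′ (λ (ℓ , ℓ<1+r , w) → ℓ , s≤s⁻¹ ℓ<1+r , w) (λ (ℓ , ℓ≤r , w) → ℓ , s≤s ℓ≤r , w)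
    (anyUpTo? (walkFromSpecial? v) (suc r))

  near-mono : ∀ {r r′ v} → r ≤ r′ → Near r v → Near r′ v
  near-mono r≤r′ (ℓ , ℓ≤r , w) = ℓ , ≤-trans ℓ≤r r≤r′ , w

  special⇒near : ∀ {r v} → Special v → Near r v
  special⇒near special = 0 , z≤n , _ , special , here

  near-walk : ∀ {r ℓ u v} → Near r u → Walk G ℓ u v → Near (r + ℓ) v
  near-walk {ℓ = ℓ} (ℓ₀ , ℓ₀≤r , u₀ , special , u₀⇝u) u⇝v =
    ℓ₀ + ℓ , +-monoˡ-≤ ℓ ℓ₀≤r , u₀ , special , walk-++ u₀⇝u u⇝v

module Exchange (ℋ : List Graph) (D : ℕ) (conn : ∀ H → H ∈ ℋ → ConnDiam D H)
                (d : ℕ) (G G′ : Graph) (ι : Embedding G′ G) where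

  open Distance ℋ d G

  f : Fin (n G′) → Fin (n G)
  f = proj₁ ι

  Pair′ : Set
  Pair′ = Fin (n G′) × Fin (n G′)

  Far : ℕ → Fin (n G′) → Set
  Far r a = ¬ Near r (f a)

  FarPair : ℕ → Pair′ → Set
  FarPair r p = Far r (proj₁ p) × Far r (proj₂ p)

  farPair? : ∀ r → Decidable (FarPair r)
  farPair? r p = ¬? (near? r _) ×-dec ¬? (near? r _)

  farPair-anti : ∀ {r r′ p} → r ≤ r′ → FarPair r′ p → FarPair r p
  farPair-anti r≤r′ (far₁ , far₂) = far₁ ∘ near-mono r≤r′ , far₂ ∘ near-mono r≤r′

  farCount : ℕ → List Pair′ → ℕ
  farCount r F = length (filter (farPair? r) F)

  preimage? : ∀ y → Dec (∃ λ x → f x ≡ y)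
  preimage? y = any? λ x → f x ≟ y

  -- The edges of G′ at a, enumerated through the neighbours of f a in G so that their number
  -- is bounded by degree G (f a).
  starWithin : Fin (n G′) → List (Fin (n G)) → List Pair′
  starWithin a []       = []
  starWithin a (y ∷ ys) with adj G (f a) y | preimage? y
  ... | true | yes (x , _) = (a , x) ∷ starWithin a ys
  ... | _    | _           = starWithin a ys

  length-starWithin : ∀ a ys →
    length (starWithin a ys) ≤ sum (map (λ j → if adj G (f a) j then 1 else 0) ys)
  length-starWithin a []       = z≤n
  length-starWithin a (y ∷ ys) with adj G (f a) y | preimage? y
  ... | true  | yes _ = s≤s (length-starWithin a ys)
  ... | true  | no _  = m≤n⇒m≤1+n (length-starWithin a ys)
  ... | false | _     = length-starWithin a ys

  starWithin-fst : ∀ {a p} ys → p ∈ starWithin a ys → proj₁ p ≡ a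
  starWithin-fst {a} (y ∷ ys) p∈ with adj G (f a) y | preimage? y | p∈
  ... | true  | yes _ | here refl = refl
  ... | true  | yes _ | there p∈′ = starWithin-fst ys p∈′
  ... | true  | no _  | p∈′       = starWithin-fst ys p∈′
  ... | false | _     | p∈′       = starWithin-fst ys p∈′

  starWithin-complete : ∀ {a x} ys → f x ∈ ys → adj G (f a) (f x) ≡ true → (a , x) ∈ starWithin a ys
  starWithin-complete {a} {x} (y ∷ ys) (here refl) a~x with adj G (f a) (f x) | preimage? (f x)
  ... | true  | yes (x′ , fx′≡fx) = here (cong (a ,_) (sym (proj₁ (proj₂ ι) fx′≡fx)))
  ... | true  | no no-preimage    = contradiction (x , refl) no-preimage
  ... | false | _                 = contradiction a~x λ ()
  starWithin-complete {a} (y ∷ ys) (there x∈) a~x with adj G (f a) y | preimage? y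
  ... | true  | yes _ = there (starWithin-complete ys x∈ a~x)
  ... | true  | no _  = starWithin-complete ys x∈ a~x
  ... | false | _     = starWithin-complete ys x∈ a~x

  star : Fin (n G′) → List Pair′
  star a = starWithin a (allFin (n G))

  stars : List Pair′ → List Pair′
  stars []            = []
  stars ((a , b) ∷ Y) = star a ++ star b ++ stars Y

  endpoints : List Pair′ → List (Fin (n G′))
  endpoints []            = []
  endpoints ((a , b) ∷ Y) = a ∷ b ∷ endpoints Y

  ∈⇒endpoint : ∀ {a b Y} → (a , b) ∈ Y → a ∈ endpoints Y
  ∈⇒endpoint {Y = _ ∷ Y} (here refl) = here refl
  ∈⇒endpoint {Y = _ ∷ Y} (there ab∈) = there (there (∈⇒endpoint ab∈))

  length-stars : ∀ Y → (∀ {c} → c ∈ endpoints Y → degree G (f c) ≤ d) →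
    length (stars Y) ≤ 2 * d * length Y
  length-stars []            _   = z≤n
  length-stars ((a , b) ∷ Y) deg = begin
      length (star a ++ star b ++ stars Y)                     ≡⟨ length-++ (star a) ⟩
      length (star a) + length (star b ++ stars Y)             ≡⟨ cong (length (star a) +_) (length-++ (star b)) ⟩
      length (star a) + (length (star b) + length (stars Y))   ≤⟨ +-mono-≤ (star≤ a (here refl))
                                                                    (+-mono-≤ (star≤ b (there (here refl)))
                                                                      (length-stars Y (deg ∘ there ∘ there))) ⟩
      d + (d + 2 * d * length Y)                               ≡⟨ solve 2 (λ d y → d :+ (d :+ con 2 :* d :* y)
                                                                    := con 2 :* d :* (con 1 :+ y)) refl d (length Y) ⟩
      2 * d * suc (length Y)                                   ∎
    where
    open ≤-Reasoning
    star≤ : ∀ c → c ∈ endpoints ((a , b) ∷ Y) → length (star c) ≤ d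
    star≤ c c∈ = ≤-trans (length-starWithin c (allFin (n G))) (deg c∈)

  stars-endpoint : ∀ {q} Y → q ∈ stars Y → proj₁ q ∈ endpoints Y
  stars-endpoint ((a , b) ∷ Y) q∈ with ∈-++⁻ (star a) q∈
  ... | inj₁ q∈a = here (starWithin-fst (allFin (n G)) q∈a)
  ... | inj₂ q∈′ with ∈-++⁻ (star b) q∈′
  ...   | inj₁ q∈b = there (here (starWithin-fst (allFin (n G)) q∈b))
  ...   | inj₂ q∈Y = there (there (stars-endpoint Y q∈Y))

  stars-complete : ∀ {c x} Y → c ∈ endpoints Y → adj G′ c x ≡ true → (c , x) ∈ stars Y
  stars-complete {c} {x} ((a , b) ∷ Y) (here refl) c~x =
    ∈-++⁺ˡ (starWithin-complete (allFin (n G)) (∈-allFin (f x)) (embedding-edgePreserving {G′} {G} ι c~x))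
  stars-complete {c} {x} ((a , b) ∷ Y) (there (here refl)) c~x =
    ∈-++⁺ʳ (star a)
      (∈-++⁺ˡ (starWithin-complete (allFin (n G)) (∈-allFin (f x)) (embedding-edgePreserving {G′} {G} ι c~x)))
  stars-complete ((a , b) ∷ Y) (there (there c∈)) c~x =
    ∈-++⁺ʳ (star a) (∈-++⁺ʳ (star b) (stars-complete Y c∈ c~x))

  endpoint-far : ∀ {r c} Y → (∀ {p} → p ∈ Y → FarPair r p) → c ∈ endpoints Y → Far r c
  endpoint-far (_ ∷ Y) far (here refl)         = proj₁ (far (here refl))
  endpoint-far (_ ∷ Y) far (there (here refl)) = proj₂ (far (here refl))
  endpoint-far (_ ∷ Y) far (there (there c∈))  = endpoint-far Y (far ∘ there) c∈

  module Exchanged (F : List Pair′) (r : ℕ) where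

    inner outer beyond rim exchange : List Pair′
    inner    = filter (¬? ∘ farPair? r) F
    outer    = filter (farPair? r) F
    beyond   = filter (farPair? (r + D)) outer
    rim      = filter (¬? ∘ farPair? (r + D)) outer
    exchange = inner ++ stars rim

    rim-far : ∀ {p} → p ∈ rim → FarPair r p
    rim-far p∈ =
      proj₂ (∈-filter⁻ (farPair? r) {xs = F} (proj₁ (∈-filter⁻ (¬? ∘ farPair? (r + D)) {xs = outer} p∈)))

    rim-endpoint-far : ∀ {c} → c ∈ endpoints rim → Far r c
    rim-endpoint-far = endpoint-far rim rim-far

    rim-endpoint-isolated : ∀ {c} → c ∈ endpoints rim → ∀ x → adj (deleteEdges G′ exchange) c x ≡ false
    rim-endpoint-isolated {c} c∈ x with adj G′ c x in c~x
    ... | true  = trans (cong (_∧ not (hit exchange c x ∨ hit exchange x c)) (sym c~x))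
                    (deleteEdges-hit G′ exchange (∈⇒hit (∈-++⁺ʳ inner (stars-complete rim c∈ c~x))))
    ... | false = refl

    hit-exchange : ∀ {a b} → hit exchange a b ≡ true →
      ((a , b) ∈ F × ¬ FarPair r (a , b)) ⊎ a ∈ endpoints rim
    hit-exchange h with ∈-++⁻ inner (hit⇒∈ exchange h)
    ... | inj₁ ∈inner = inj₁ (∈-filter⁻ (¬? ∘ farPair? r) ∈inner)
    ... | inj₂ ∈stars = inj₂ (stars-endpoint rim ∈stars)

    classify : ∀ {p} → p ∈ F → p ∈ inner ⊎ FarPair (r + D) p ⊎ p ∈ rim
    classify {p} p∈F with farPair? r p
    ... | no near-r = inj₁ (∈-filter⁺ (¬? ∘ farPair? r) p∈F near-r)
    ... | yes far-r with farPair? (r + D) p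
    ...   | yes far-r+D = inj₂ (inj₁ far-r+D)
    ...   | no near-r+D =
      inj₂ (inj₂ (∈-filter⁺ (¬? ∘ farPair? (r + D)) (∈-filter⁺ (farPair? r) p∈F far-r) near-r+D))

    module Copy {H} (H∈ℋ : H ∈ ℋ) (e : Embedding H (deleteEdges G′ exchange)) where

      φ : Fin (n H) → Fin (n G′)
      φ = proj₁ e

      φ-adj : ∀ i j → adj H i j ≡ adj (deleteEdges G′ exchange) (φ i) (φ j)
      φ-adj = proj₂ (proj₂ e)

      fφ-edgePreserving : EdgePreserving H G (f ∘ φ)
      fφ-edgePreserving = embedding-edgePreserving {G′} {G} ι ∘ deleteEdges-⊆ G′ exchange
                          ∘ embedding-edgePreserving {H} {deleteEdges G′ exchange} e

      -- A rim endpoint is isolated after the exchange, while H is connected; a one-vertex H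
      -- would make every vertex of G special, but rim endpoints are far.
      avoids-rim : ∀ i → ¬ φ i ∈ endpoints rim
      avoids-rim i φi∈ with all? (λ j → j ≟ i)
      ... | yes only = rim-endpoint-far φi∈
                         (special⇒near (inj₁ (H , H∈ℋ , point-embedding H G i only (f (φ i)) , i , refl)))
      ... | no ¬only with ¬∀⟶∃¬ _ _ (λ j → j ≟ i) ¬only
      ...   | j , j≢i with connected-neighbour (conn H H∈ℋ) (j≢i ∘ sym)
      ...     | w , i~w =
        contradiction (trans (sym i~w) (trans (φ-adj i w) (rim-endpoint-isolated φi∈ (φ w)))) λ ()

      -- If one vertex is beyond r + D, all are beyond r (diameter ≤ D), so the exchange
      -- deletes nothing inside the copy and its vertices are special.
      all-near : ∀ i₀ → Near (r + D) (f (φ i₀))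
      all-near i₀ with near? (r + D) (f (φ i₀))
      ... | yes near = near
      ... | no far = ⊥-elim (far (special⇒near (special i₀)))
        where
        all-far : ∀ i → Far r (φ i)
        all-far i near-i with proj₂ (conn H H∈ℋ) i i₀
        ... | ℓ , ℓ≤D , i⇝i₀ = far (near-mono (+-monoʳ-≤ r ℓ≤D)
                                  (near-walk near-i (walk-map (f ∘ φ) fφ-edgePreserving i⇝i₀)))
        unhit : ∀ i j → hit exchange (φ i) (φ j) ≡ false
        unhit i j = ¬-not λ h →
          [ (λ (_ , ¬far) → ¬far (all-far i , all-far j)) , avoids-rim i ] (hit-exchange h)
        special : ∀ i → Special (f (φ i))
        special i =
          inj₁ (H , H∈ℋ , ∘-embedding {H} {G′} {G} ι (unhit-embedding {H} G′ exchange e unhit) , i , refl)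

      -- Away from the rim and within r + D, the exchange agrees with F.
      into-F : Embedding H (deleteEdges G′ F)
      into-F = embedding-along {H} {deleteEdges G′ exchange} {deleteEdges G′ F} e id (λ eq → eq)
        (λ i j → deleteEdges-cong G′ exchange F (same-hit i j) (same-hit j i))
        where
        same-hit : ∀ i j → hit exchange (φ i) (φ j) ≡ hit F (φ i) (φ j)
        same-hit i j = ⇔→≡ (mk⇔
          (λ h → [ ∈⇒hit ∘ proj₁ , ⊥-elim ∘ avoids-rim i ] (hit-exchange h))
          (λ h → [ ∈⇒hit ∘ ∈-++⁺ˡ , [ (λ far → ⊥-elim (proj₁ far (all-near i)))
                                    , (⊥-elim ∘ avoids-rim i ∘ ∈⇒endpoint) ] ] (classify (hit⇒∈ F h))))

    exchange-solves : Free ℋ (deleteEdges G′ F) → Free ℋ (deleteEdges G′ exchange)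
    exchange-solves F-solves H H∈ℋ e = F-solves H H∈ℋ (Copy.into-F H∈ℋ e)

  module MinimumSolution (F : List Pair′) (F-solves : Free ℋ (deleteEdges G′ F))
                         (F-minimum : ∀ L → Free ℋ (deleteEdges G′ L) → length F ≤ length L) where

    farCount-step : ∀ r → 2 * d * farCount (r + D) F ≤ (2 * d ∸ 1) * farCount r F
    farCount-step r = begin
        2 * d * farCount (r + D) F                  ≡⟨ cong (2 * d *_) (sym beyond≡) ⟩
        2 * d * length beyond                       ≤⟨ exchange-arith (2 * d) _ _ outer≤ ⟩
        (2 * d ∸ 1) * (length beyond + length rim)  ≡⟨ cong ((2 * d ∸ 1) *_) outer≡ ⟩
        (2 * d ∸ 1) * farCount r F                  ∎
      where
      open Exchanged F r
      open ≤-Reasoning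
      beyond≡ : length beyond ≡ farCount (r + D) F
      beyond≡ = length-filter-filter (farPair? (r + D)) (farPair? r) (farPair-anti (m≤m+n r D)) F
      outer≡ : length beyond + length rim ≡ length outer
      outer≡ = length-filter-+-∁ (farPair? (r + D)) outer
      rim-degree : ∀ {c} → c ∈ endpoints rim → degree G (f c) ≤ d
      rim-degree c∈ = ¬special⇒degree≤ (rim-endpoint-far c∈ ∘ special⇒near)
      outer≤ : length beyond + length rim ≤ 2 * d * length rim
      outer≤ = +-cancelʳ-≤ (length inner) _ _ (begin
          length beyond + length rim + length inner  ≡⟨ cong (_+ length inner) outer≡ ⟩
          length outer + length inner                ≡⟨ length-filter-+-∁ (farPair? r) F ⟩
          length F                                   ≤⟨ F-minimum exchange (exchange-solves F-solves) ⟩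
          length exchange                            ≡⟨ length-++ inner ⟩
          length inner + length (stars rim)          ≤⟨ +-monoʳ-≤ (length inner) (length-stars rim rim-degree) ⟩
          length inner + 2 * d * length rim          ≡⟨ +-comm (length inner) _ ⟩
          2 * d * length rim + length inner          ∎)

    farCount-decay : ∀ {k} → length F ≤ k → ∀ j → (2 * d) ^ j * farCount (j * D) F ≤ (2 * d ∸ 1) ^ j * k
    farCount-decay F≤k zero    = *-monoʳ-≤ 1 (≤-trans (length-filter (farPair? 0) F) F≤k)
    farCount-decay {k} F≤k (suc j) = begin
        a * a ^ j * farCount (D + j * D) F      ≡⟨ cong (λ z → a * a ^ j * farCount z F) (+-comm D (j * D)) ⟩
        a * a ^ j * farCount (j * D + D) F      ≡⟨ solve 3 (λ a b x → a :* b :* x := b :* (a :* x)) refl a (a ^ j) _ ⟩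
        a ^ j * (a * farCount (j * D + D) F)    ≤⟨ *-monoʳ-≤ (a ^ j) (farCount-step (j * D)) ⟩
        a ^ j * (q * farCount (j * D) F)        ≡⟨ solve 3 (λ a b x → a :* (b :* x) := b :* (a :* x)) refl (a ^ j) q _ ⟩
        q * (a ^ j * farCount (j * D) F)        ≤⟨ *-monoʳ-≤ q (farCount-decay F≤k j) ⟩
        q * (q ^ j * k)                         ≡⟨ sym (*-assoc q (q ^ j) k) ⟩
        q * q ^ j * k                           ∎
      where
      open ≤-Reasoning
      a = 2 * d
      q = 2 * d ∸ 1

    far-edge-bound : ∀ {k p m} {{_ : NonZero D}} → length F ≤ k → p ∈ F → FarPair (D + m) p →
      ∃ λ j → (2 * d) ^ j ≤ (2 * d ∸ 1) ^ j * k × suc m ≤ j * D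
    far-edge-bound {k} {p} {m} F≤k p∈F far = j , power-bound , +-cancelˡ-< D m (j * D) (proj₂ bounds)
      where
      open ≤-Reasoning
      bounds = quotient-bounds (D + m) D
      j = (D + m) / D
      counted : 1 ≤ farCount (j * D) F
      counted = filter-some (farPair? (j * D)) (lose p∈F (farPair-anti (proj₁ bounds) far))
      power-bound : (2 * d) ^ j ≤ (2 * d ∸ 1) ^ j * k
      power-bound = begin
        (2 * d) ^ j                          ≡⟨ sym (*-identityʳ _) ⟩
        (2 * d) ^ j * 1                      ≤⟨ *-monoʳ-≤ ((2 * d) ^ j) counted ⟩
        (2 * d) ^ j * farCount (j * D) F     ≤⟨ farCount-decay F≤k j ⟩
        (2 * d ∸ 1) ^ j * k                  ∎

module Reduction (ℋ : List Graph) (D : ℕ) {{_ : NonZero D}} (conn : ∀ H → H ∈ ℋ → ConnDiam D H)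
                 (d k : ℕ) (k≥1 : 1 ≤ k) (G G′ : Graph) (ι : Embedding G′ G)
                 (kept : ∀ i → Kept ℋ d k D G (proj₁ ι i))
                 (covers : ∀ v → Kept ℋ d k D G v → ∃ λ i → proj₁ ι i ≡ v) where

  open Distance ℋ d G
  open Exchange ℋ D conn d G G′ ι

  f-injective : Injective _≡_ _≡_ f
  f-injective = proj₁ (proj₂ ι)

  f-adj : ∀ a b → adj G′ a b ≡ adj G (f a) (f b)
  f-adj = proj₂ (proj₂ ι)

  special-kept : ∀ {v} → Special v → Kept ℋ d k D G v
  special-kept special = _ , special , 0 , here ,
    withinBound-intro {d} {k} {D} k≥1 λ m 0∸2D≡1+m → ⊥-elim (0≢1+n (trans (sym (0∸n≡0 (2 * D))) 0∸2D≡1+m))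

  restrict : List (Fin (n G) × Fin (n G)) → List Pair′
  restrict []            = []
  restrict ((u , v) ∷ L) with preimage? u | preimage? v
  ... | yes (a , _) | yes (b , _) = (a , b) ∷ restrict L
  ... | _           | _           = restrict L

  length-restrict : ∀ L → length (restrict L) ≤ length L
  length-restrict []            = z≤n
  length-restrict ((u , v) ∷ L) with preimage? u | preimage? v
  ... | yes _ | yes _ = s≤s (length-restrict L)
  ... | yes _ | no _  = m≤n⇒m≤1+n (length-restrict L)
  ... | no _  | _     = m≤n⇒m≤1+n (length-restrict L)

  ∈-restrict⁻ : ∀ L {a b} → (a , b) ∈ restrict L → (f a , f b) ∈ L
  ∈-restrict⁻ ((u , v) ∷ L) ab∈ with preimage? u | preimage? v | ab∈
  ... | yes (_ , refl) | yes (_ , refl) | here refl = here refl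
  ... | yes _          | yes _          | there ab∈′ = there (∈-restrict⁻ L ab∈′)
  ... | yes _          | no _           | ab∈′       = there (∈-restrict⁻ L ab∈′)
  ... | no _           | _              | ab∈′       = there (∈-restrict⁻ L ab∈′)

  ∈-restrict⁺ : ∀ L {a b} → (f a , f b) ∈ L → (a , b) ∈ restrict L
  ∈-restrict⁺ ((u , v) ∷ L) {a} {b} (here refl) with preimage? (f a) | preimage? (f b)
  ... | yes (a′ , fa′≡fa) | yes (b′ , fb′≡fb) = here (cong₂ _,_ (f-injective (sym fa′≡fa)) (f-injective (sym fb′≡fb)))
  ... | yes _ | no no-preimage = contradiction (b , refl) no-preimage
  ... | no no-preimage | _     = contradiction (a , refl) no-preimage
  ∈-restrict⁺ ((u , v) ∷ L) (there ab∈) with preimage? u | preimage? v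
  ... | yes _ | yes _ = there (∈-restrict⁺ L ab∈)
  ... | yes _ | no _  = ∈-restrict⁺ L ab∈
  ... | no _  | _     = ∈-restrict⁺ L ab∈

  hit-restrict : ∀ L a b → hit (restrict L) a b ≡ hit L (f a) (f b)
  hit-restrict L a b = ⇔→≡ (mk⇔ (∈⇒hit ∘ ∈-restrict⁻ L ∘ hit⇒∈ (restrict L))
                                (∈⇒hit ∘ ∈-restrict⁺ L ∘ hit⇒∈ L))

  restriction-solves : ∀ {L} → Free ℋ (deleteEdges G L) → Free ℋ (deleteEdges G′ (restrict L))
  restriction-solves {L} L-solves H H∈ℋ e = L-solves H H∈ℋ
    (embedding-along {H} {deleteEdges G′ (restrict L)} {deleteEdges G L} e f f-injective λ i j →
      cong₂ _∧_ (f-adj _ _) (cong not (cong₂ _∨_ (hit-restrict L _ _) (hit-restrict L _ _))))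

  lift : List Pair′ → List (Fin (n G) × Fin (n G))
  lift = map (λ p → f (proj₁ p) , f (proj₂ p))

  lift-adj : ∀ F a b → adj (deleteEdges G (lift F)) (f a) (f b) ≡ adj (deleteEdges G′ F) a b
  lift-adj F a b = cong₂ _∧_ (sym (f-adj a b))
    (cong not (cong₂ _∨_ (hit-map f-injective F a b) (hit-map f-injective F b a)))

  pullback : ∀ {H F} (e : Embedding H (deleteEdges G (lift F))) → (∀ i → ∃ λ a → f a ≡ proj₁ e i) →
    Embedding H (deleteEdges G′ F)
  pullback {H} {F} (e , e-inj , e-adj) preimage = proj₁ ∘ preimage , injective , adjacency
    where
    injective : Injective _≡_ _≡_ (proj₁ ∘ preimage)
    injective {i} {j} eq = e-inj (trans (sym (proj₂ (preimage i))) (trans (cong f eq) (proj₂ (preimage j))))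
    adjacency : ∀ i j → adj H i j ≡ adj (deleteEdges G′ F) (proj₁ (preimage i)) (proj₁ (preimage j))
    adjacency i j = trans (e-adj i j)
      (trans (cong₂ (adj (deleteEdges G (lift F))) (sym (proj₂ (preimage i))) (sym (proj₂ (preimage j))))
             (lift-adj F _ _))

  copy-walk : ∀ {H L} → H ∈ ℋ → (e : Embedding H (deleteEdges G L)) → ∀ i j →
    ∃ λ ℓ → ℓ ≤ D × Walk G ℓ (proj₁ e i) (proj₁ e j)
  copy-walk {H} {L} H∈ℋ e i j with proj₂ (conn H H∈ℋ) i j
  ... | ℓ , ℓ≤D , i⇝j =
    ℓ , ℓ≤D , walk-map (proj₁ e) (deleteEdges-⊆ G L ∘ embedding-edgePreserving {H} {deleteEdges G L} e) i⇝j

  reach : ∀ {a ℓ w} → Walk G ℓ (f a) w → ∃ λ δ → WalkFromSpecial δ w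
  reach {a} a⇝w with kept a
  ... | u , special , _ , u⇝a , _ = _ , u , special , walk-++ u⇝a a⇝w

  module Lifted (F : List Pair′) (F-solves : Free ℋ (deleteEdges G′ F))
                (F-minimum : ∀ L → Free ℋ (deleteEdges G′ L) → length F ≤ length L)
                (F≤k : length F ≤ k) where

    open MinimumSolution F F-solves F-minimum

    kept-near-edge : ∀ {p w ℓ₁ ℓ₂} → p ∈ F →
      ℓ₁ ≤ D → Walk G ℓ₁ (f (proj₁ p)) w → ℓ₂ ≤ D → Walk G ℓ₂ (f (proj₂ p)) w → Kept ℋ d k D G w
    kept-near-edge {p} {w} p∈F ℓ₁≤D p₁⇝w ℓ₂≤D p₂⇝w
      with minimal (walkFromSpecial? w) (proj₂ (reach p₁⇝w))
    ... | δ , (u , special , u⇝w) , closest =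
      u , special , δ , u⇝w , withinBound-intro {d} {k} {D} k≥1 λ m δ∸2D≡1+m →
        far-edge-bound F≤k p∈F (far-endpoint δ∸2D≡1+m ℓ₁≤D p₁⇝w , far-endpoint δ∸2D≡1+m ℓ₂≤D p₂⇝w)
      where
      far-endpoint : ∀ {m x ℓ} → δ ∸ 2 * D ≡ suc m → ℓ ≤ D → Walk G ℓ (f x) w → Far (D + m) x
      far-endpoint {m} {x} {ℓ} δ∸2D≡1+m ℓ≤D x⇝w near with near-walk near x⇝w
      ... | ℓ′ , ℓ′≤ , from-special = closest ℓ′<δ from-special
        where
        open ≤-Reasoning
        2D≤δ : 2 * D ≤ δ
        2D≤δ = <⇒≤ (m∸n≢0⇒n<m λ δ∸2D≡0 → 0≢1+n (trans (sym δ∸2D≡0) δ∸2D≡1+m))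
        ℓ′<δ : ℓ′ < δ
        ℓ′<δ = begin-strict
          ℓ′                     ≤⟨ ℓ′≤ ⟩
          D + m + ℓ              ≤⟨ +-monoʳ-≤ (D + m) ℓ≤D ⟩
          D + m + D              <⟨ ≤-reflexive (solve 2 (λ D m → con 1 :+ (D :+ m :+ D)
                                      := con 2 :* D :+ (con 1 :+ m)) refl D m) ⟩
          2 * D + suc m          ≡⟨ cong (2 * D +_) (sym δ∸2D≡1+m) ⟩
          2 * D + (δ ∸ 2 * D)    ≡⟨ m+[n∸m]≡n 2D≤δ ⟩
          δ                      ∎

    copy-vertex-kept : ∀ {H} → H ∈ ℋ → (e : Embedding H (deleteEdges G (lift F))) → ∀ i₀ →
      Kept ℋ d k D G (proj₁ e i₀)
    copy-vertex-kept {H} H∈ℋ e i₀ with ∃-pair? (λ (i , j) → hit (lift F) (proj₁ e i) (proj₁ e j) ≟ᵇ true)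
    ... | no unhit = special-kept (inj₁ (H , H∈ℋ , unhit-embedding {H} G (lift F) e
                       (λ i j → ¬-not λ h → unhit ((i , j) , h)) , i₀ , refl))
    ... | yes ((i , j) , h) with ∈-map⁻ _ (hit⇒∈ (lift F) h)
    ...   | p , p∈F , eq with copy-walk {H} {lift F} H∈ℋ e i i₀ | copy-walk {H} {lift F} H∈ℋ e j i₀
    ...     | ℓ₁ , ℓ₁≤D , i⇝i₀ | ℓ₂ , ℓ₂≤D , j⇝i₀ =
      kept-near-edge p∈F ℓ₁≤D (subst (λ x → Walk G ℓ₁ x _) (cong proj₁ eq) i⇝i₀)
                         ℓ₂≤D (subst (λ x → Walk G ℓ₂ x _) (cong proj₂ eq) j⇝i₀)

    lift-solves : Free ℋ (deleteEdges G (lift F))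
    lift-solves H H∈ℋ e with all? (λ i → preimage? (proj₁ e i))
    ... | yes preimage = F-solves H H∈ℋ (pullback {H} {F} e preimage)
    ... | no ¬preimage with ¬∀⟶∃¬ _ _ (λ i → preimage? (proj₁ e i)) ¬preimage
    ...   | i₀ , no-preimage = no-preimage (covers _ (copy-vertex-kept H∈ℋ e i₀))

  yes⇒yes′ : YesInstance ℋ G k → YesInstance ℋ G′ k
  yes⇒yes′ (L , L≤k , L-solves) = restrict L , ≤-trans (length-restrict L) L≤k , restriction-solves {L} L-solves

  yes′⇒yes : YesInstance ℋ G′ k → YesInstance ℋ G k
  yes′⇒yes yes′ with minimum-solution ℋ G′ yes′
  ... | F , F≤k , F-solves , F-minimum =
    lift F , subst (_≤ k) (sym (length-map _ F)) F≤k , Lifted.lift-solves F F-solves F-minimum F≤k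

lemma11 : (ℋ : List Graph) (D : ℕ) → (∀ H → H ∈ ℋ → ConnDiam D H) →
    (s : ℕ) → 1 < s → (∃ λ H → H ∈ ℋ × Iso H (Star s)) →
    (∀ s′ → 1 < s′ → s′ < s → ¬ (∃ λ H → H ∈ ℋ × Iso H (Star s′))) →
    (t : ℕ) → 2 < t → (d : ℕ) → IsRamsey s (t ∸ 1) (suc d) →
    (G : Graph) (k : ℕ) → 1 ≤ k → KFree t G →
    (G′ : Graph) → InducedOn G (Kept ℋ d k D G) G′ →
    (YesInstance ℋ G k ⇔ YesInstance ℋ G′ k)
lemma11 ℋ D conn s 1<s (H , H∈ℋ , H≅star) _ t _ d _ G k k≥1 _ G′ (f , f-inj , f-adj , kept , covers) =
  mk⇔ yes⇒yes′ yes′⇒yes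
  where
  instance
    D≢0 : NonZero D
    D≢0 = nonZero-diameter 1<s (conn H H∈ℋ) H≅star
  open Reduction ℋ D conn d k k≥1 G G′ (f , f-inj , f-adj) kept covers
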